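{- For all formulas $A$ and $B$ of the language $\{{\sim},\wedge,\vee\}$: $B\models_{\bf CNL^2_4}A\vee{\sim}{\sim}A$; $B\models_{\bf CNL^2_4}{\sim}(A\vee{\sim}{\sim}A)$; $A\wedge{\sim}{\sim}A\models_{\bf CNL^2_4}B$; ${\sim}(A\wedge{\sim}{\sim}A)\models_{\bf CNL^2_4}B$.
   Context: Formulas are built from a countable set of propositional variables using ${\sim}$ (unary) and $\wedge,\vee$ (binary). A {\bf CNL$^2_4$}-interpretation assigns each variable a value in $\{\mathbf{1},\mathbf{i},\mathbf{j},\mathbf{0}\}$ and is extended to all formulas by the truth tables: ${\sim}\mathbf{1}=\mathbf{i}$, ${\sim}\mathbf{i}=\mathbf{0}$, ${\sim}\mathbf{j}=\mathbf{1}$, ${\sim}\mathbf{0}=\mathbf{j}$; $\wedge$: $\mathbf{1}\wedge x=x\wedge\mathbf{1}=x$, $\mathbf{0}\wedge x=x\wedge\mathbf{0}=\mathbf{0}$, $\mathbf{i}\wedge\mathbf{i}=\mathbf{i}$, $\mathbf{j}\wedge\mathbf{j}=\mathbf{j}$, $\mathbf{i}\wedge\mathbf{j}=\mathbf{j}\wedge\mathbf{i}=\mathbf{0}$; $\vee$: $\mathbf{1}\vee x=x\vee\mathbf{1}=\mathbf{1}$, $\mathbf{0}\vee x=x\vee\mathbf{0}=x$, $\mathbf{i}\vee\mathbf{i}=\mathbf{i}$, $\mathbf{j}\vee\mathbf{j}=\mathbf{j}$, $\mathbf{i}\vee\mathbf{j}=\mathbf{j}\vee\mathbf{i}=\mathbf{1}$.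 $\Gamma\models_{\bf CNL^2_4}A$ iff for every interpretation, if every member of $\Gamma$ takes a value in $\mathcal{D}=\{\mathbf{1},\mathbf{i}\}$ then $A$ takes a value in $\mathcal{D}$; a single premise $B$ means $\Gamma=\{B\}$. -}

module Defs where

open import Data.Nat using (ℕ)
open import Data.Product using (_×_)

data Formula : Set where
  var  : ℕ → Formula
  ~_   : Formula → Formula
  _∧_  : Formula → Formula → Formula
  _∨_  : Formula → Formula → Formula

infix  9 ~_
infixr 7 _∧_
infixr 6 _∨_

data V4 : Set where
  v1 vi vj v0 : V4

neg : V4 → V4
neg v1 = vi
neg vi = v0
neg vj = v1
neg v0 = vj

conj : V4 → V4 → V4
conj v1 x  = x
conj v0 x  = v0
conj vi v1 = vi
conj vi vi = vi
conj vi vj = v0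
conj vi v0 = v0
conj vj v1 = vj
conj vj vi = v0
conj vj vj = vj
conj vj v0 = v0

disj : V4 → V4 → V4
disj v1 x  = v1
disj v0 x  = x
disj vi v1 = v1
disj vi vi = vi
disj vi vj = v1
disj vi v0 = vi
disj vj v1 = v1
disj vj vi = v1
disj vj vj = vj
disj vj v0 = vj

Interpretation : Set
Interpretation = ℕ → V4

eval : Interpretation → Formula → V4
eval v (var n) = v n
eval v (~ A)   = neg (eval v A)
eval v (A ∧ B) = conj (eval v A) (eval v B)
eval v (A ∨ B) = disj (eval v A) (eval v B)

data Designated : V4 → Set where
  d1 : Designated v1
  di : Designated vi

-- Single-premise consequence B ⊨ A (Γ = {B})
_⊨_ : Formula → Formula → Set
B ⊨ A = (v : Interpretation) → Designated (eval v B) → Designated (eval v A)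

infix 4 _⊨_

{-# OPTIONS --safe #-}
module Submission where

open import Defs
open import Data.Product using (_×_; _,_)
open import Relation.Binary.PropositionalEquality using (_≡_; refl; sym; cong; subst)
open import Relation.Nullary using (¬_)
open import Data.Empty using (⊥-elim)

disj-neg-neg≡v1 : ∀ x → disj x (neg (neg x)) ≡ v1
disj-neg-neg≡v1 v1 = refl
disj-neg-neg≡v1 vi = refl
disj-neg-neg≡v1 vj = refl
disj-neg-neg≡v1 v0 = refl

conj-neg-neg≡v0 : ∀ x → conj x (neg (neg x)) ≡ v0
conj-neg-neg≡v0 v1 = refl
conj-neg-neg≡v0 vi = refl
conj-neg-neg≡v0 vj = refl
conj-neg-neg≡v0 v0 = refl

¬Designated-v0 : ¬ Designated v0
¬Designated-v0 ()

¬Designated-vj : ¬ Designated vj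
¬Designated-vj ()

valid⇒⊨ : ∀ A B → (∀ v → Designated (eval v A)) → B ⊨ A
valid⇒⊨ A B valid v _ = valid v

unsatisfiable⇒⊨ : ∀ B A → (∀ v → ¬ Designated (eval v B)) → B ⊨ A
unsatisfiable⇒⊨ B A unsat v d = ⊥-elim (unsat v d)

mainTheorem5 : (A B : Formula) →
    (B ⊨ A ∨ ~ ~ A) × (B ⊨ ~ (A ∨ ~ ~ A)) ×
    (A ∧ ~ ~ A ⊨ B) × (~ (A ∧ ~ ~ A) ⊨ B)
mainTheorem5 A B =
  valid⇒⊨ (A ∨ ~ ~ A) B (λ v → subst Designated (sym (∨-value v)) d1) ,
  valid⇒⊨ (~ (A ∨ ~ ~ A)) B (λ v → subst Designated (sym (cong neg (∨-value v))) di) ,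
  unsatisfiable⇒⊨ (A ∧ ~ ~ A) B (λ v d → ¬Designated-v0 (subst Designated (∧-value v) d)) ,
  unsatisfiable⇒⊨ (~ (A ∧ ~ ~ A)) B (λ v d → ¬Designated-vj (subst Designated (cong neg (∧-value v)) d))
  where
  ∨-value : ∀ v → eval v (A ∨ ~ ~ A) ≡ v1
  ∨-value v = disj-neg-neg≡v1 (eval v A)

  ∧-value : ∀ v → eval v (A ∧ ~ ~ A) ≡ v0
  ∧-value v = conj-neg-neg≡v0 (eval v A)
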